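{- For all integers $n\ge1$, $k\ge0$, as polynomials in $q$ with coefficients in $\mathcal{G}_{n,k}$, $$\Delta\,\mathcal{X}^{\ge}_{n,k}(q) = (-1)^k\,\mathcal{X}^{>}_{n,k}(q),$$ where $\mathcal{X}^{\ge}_{n,k}(q)=\sum_{G\in\Gamma_{n,k}}\chi^{\ge}_G(q)\,G$ and $\mathcal{X}^{>}_{n,k}(q)=\sum_{G\in\Gamma_{n,k}}\chi^{>}_G(q)\,G$.
   Context: Let $\Gamma_{n,k}$ be the set of directed graphs with vertices $1,\dots,n$ and $k$ numbered edges, i.e. sequences $([a_1,b_1],\dots,[a_k,b_k])$ with $a_i,b_i\in\{1,\dots,n\}$ (loops and repeated edges allowed), and $\mathcal{G}_{n,k}$ the complex vector space with basis $\Gamma_{n,k}$. For $G\in\Gamma_{n,k}$, $\chi^{\ge}_G$ is the polynomial such that for each positive integer $q$, $\chi^{\ge}_G(q)$ is the number of maps $f:\{1,\dots,n\}\to\{1,\dots,q\}$ with $f(a)\ge f(b)$ for every edge $[a,b]$ of $G$; $\chi^{>}_G$ is the polynomial such that $\chi^{>}_G(q)$ is the number of such maps with $f(a)>f(b)$ for every edge $[a,b]$. Laplace operator: for $i\in\{1,\dots,k\}$ and $p,r\in\{1,\dots,n\}$ let $R_{p,r;i}$ replace the $i$-th edge of a graph by $[p,r]$ (keeping number $i$). Let $B_i$ be the linear operator on $\mathcal{G}_{n,k}$ defined on $G\in\Gamma_{n,k}$ with $i$-th edge $[a,b]$ by $B_i(G)=G$ if $a\ne b$ and $B_i(G)=-\sum_{m\neq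 a}R_{a,m;i}G$ if $a=b$ (sum over $m\in\{1,\dots,n\}\setminus\{a\}$). Then $\Delta=B_1\cdots B_k$, extended linearly over polynomial coefficients in $q$. -}

module Defs where

open import Data.Nat as ℕ using (ℕ; zero; suc; _≤?_)
open import Data.Integer as ℤ using (ℤ; +_; -_; _*_; _+_)
open import Data.Fin as Fin using (Fin; toℕ; _≟_)
open import Data.Fin.Properties using () renaming (_≟_ to _≟ᶠ_)
open import Data.Product using (_×_; _,_; proj₁; proj₂)
import Data.Product.Properties as PP
open import Data.Vec as Vec using (Vec; []; _∷_; lookup; _[_]≔_)
import Data.Vec.Properties as VP
open import Data.List as List using (List; []; _∷_; concatMap; map; filterᵇ; length; allFin; foldr)
open import Relation.Nullary using (Dec; yes; no; does)
open import Relation.Binary.PropositionalEquality using (_≡_)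
open import Data.Bool using (Bool; true; false; if_then_else_; not)

-- An edge [a,b] is a pair (a , b) of vertices in Fin n (vertex j+1 ↔ Fin index j).
Edge : ℕ → Set
Edge n = Fin n × Fin n

-- Γ_{n,k}: directed graphs on n vertices with k numbered edges.
Graph : ℕ → ℕ → Set
Graph n k = Vec (Edge n) k

_≟G_ : ∀ {n k} (G H : Graph n k) → Dec (G ≡ H)
_≟G_ = VP.≡-dec (PP.≡-dec _≟ᶠ_ _≟ᶠ_)

allVecs : ∀ {A : Set} → List A → (k : ℕ) → List (Vec A k)
allVecs xs zero = [] ∷ []
allVecs xs (suc k) = concatMap (λ x → map (x ∷_) (allVecs xs k)) xs

allEdges : (n : ℕ) → List (Edge n)
allEdges n = concatMap (λ a → map (a ,_) (allFin n)) (allFin n)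

allGraphs : (n k : ℕ) → List (Graph n k)
allGraphs n k = allVecs (allEdges n) k

-- all maps f : {1..n} → {1..q}, as vectors of values in Fin q
allMaps : (n q : ℕ) → List (Vec (Fin q) n)
allMaps n q = allVecs (allFin q) n

allB : ∀ {A : Set} → (A → Bool) → ∀ {k} → Vec A k → Bool
allB p [] = true
allB p (x ∷ xs) = if p x then allB p xs else false

weakOK : ∀ {n q k} → Vec (Fin q) n → Graph n k → Bool
weakOK f G = allB (λ e → does (toℕ (lookup f (proj₂ e)) ≤? toℕ (lookup f (proj₁ e)))) G

strictOK : ∀ {n q k} → Vec (Fin q) n → Graph n k → Bool
strictOK f G = allB (λ e → does (suc (toℕ (lookup f (proj₂ e))) ≤? toℕ (lookup f (proj₁ e)))) G

-- χ^≥_G(q) and χ^>_G(q) evaluated at a positive integer q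
χ≥ : ∀ {n k} → Graph n k → ℕ → ℕ
χ≥ {n} G q = length (filterᵇ (λ f → weakOK f G) (allMaps n q))

χ> : ∀ {n k} → Graph n k → ℕ → ℕ
χ> {n} G q = length (filterᵇ (λ f → strictOK f G) (allMaps n q))

LinComb : ℕ → ℕ → Set
LinComb n k = List (ℤ × Graph n k)

coeff : ∀ {n k} → Graph n k → LinComb n k → ℤ
coeff H [] = + 0
coeff H ((c , G) ∷ xs) with G ≟G H
... | yes _ = c + coeff H xs
... | no  _ = coeff H xs

R : ∀ {n k} → Fin n → Fin n → Fin k → Graph n k → Graph n k
R p r i G = G [ i ]≔ (p , r)

Bbasis : ∀ {n k} → Fin k → Graph n k → LinComb n k
Bbasis {n} i G with lookup G i
... | (a , b) with a ≟ᶠ b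
...   | no  _ = (+ 1 , G) ∷ []
...   | yes _ = map (λ m → (- (+ 1) , R a m i G))
                    (filterᵇ (λ m → not (does (m ≟ᶠ a))) (allFin n))


scale : ∀ {n k} → ℤ → LinComb n k → LinComb n k
scale c = map (λ { (d , G) → (c * d , G) })

B : ∀ {n k} → Fin k → LinComb n k → LinComb n k
B i = concatMap (λ { (c , G) → scale c (Bbasis i G) })

Δ : ∀ {n k} → LinComb n k → LinComb n k
Δ {n} {k} x = foldr B x (allFin k)

𝒳≥ : (n k q : ℕ) → LinComb n k
𝒳≥ n k q = map (λ G → (+ χ≥ G q , G)) (allGraphs n k)

𝒳> : (n k q : ℕ) → LinComb n k
𝒳> n k q = map (λ G → (+ χ> G q , G)) (allGraphs n k)

sgn : ℕ → ℤ
sgn zero = + 1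
sgn (suc k) = - sgn k

-- Rather than applying Δ to linear combinations, apply its transpose to
-- coefficient functions φ : Γ_{n,k} → ℤ.  The coefficient of H in B_i X is
-- ∂(e ↦ φ(H with i-th edge e)) evaluated at the i-th edge of H, where
--   ∂ψ[p,p] = 0   and   ∂ψ[p,r] = ψ[p,r] − ψ[p,p]  for p ≠ r.
-- The coefficient function of 𝒳^≥ is G ↦ Σ_f Π_{e ∈ G} weak_f(e) (f ranges
-- over colourings), a sum of products with one factor per edge; the i-th
-- transpose replaces the factor of the i-th edge by its ∂, so Δᵀ turns
-- Π weak_f into Π ∂weak_f = Π (−ascent_f) = (−1)^k Π ascent_f.  Mirroring
-- colours (f ↦ q+1−f) turns ascents into descents, whose count is χ^>.
module Submission where

open import Defs
open import Data.Nat using (ℕ; _≤_)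
open import Data.Integer using (_*_)
open import Relation.Binary.PropositionalEquality using (_≡_)
open import Data.Nat using (zero; suc; _≤?_; _<_; s≤s)
import Data.Nat.Properties as ℕP
open import Data.Integer using (ℤ; +_; -_; _+_; _-_)
import Data.Integer.Properties as ℤP
open import Data.Integer.Tactic.RingSolver using (solve-∀)
open import Data.Fin as Fin using (Fin; toℕ; opposite)
import Data.Fin.Properties as FinP
open import Data.Fin.Properties using () renaming (_≟_ to _≟ᶠ_)
open import Data.Product using (_×_; _,_; proj₁; proj₂)
import Data.Product.Properties as ×P
open import Data.Vec as Vec using (Vec; []; _∷_; lookup; _[_]≔_)
import Data.Vec.Properties as VecP
open import Data.List using (List; []; _∷_; _++_; concatMap; map; filterᵇ; length; allFin; foldr)
import Data.List.Properties as ListP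
open import Data.Bool using (Bool; true; false; if_then_else_; not)
open import Relation.Nullary using (Dec; yes; no; does; ¬_)
open import Relation.Binary.Definitions using (DecidableEquality)
open import Relation.Binary.PropositionalEquality using (refl; sym; trans; cong; cong₂; subst₂; module ≡-Reasoning)
open import Data.Empty using (⊥-elim)
open import Function using (_∘_)

𝟙 : Bool → ℤ
𝟙 true  = + 1
𝟙 false = + 0

⟦_⟧ : {P : Set} → Dec P → ℤ
⟦ d ⟧ = 𝟙 (does d)

⟦⟧-yes : {P : Set} → P → (d : Dec P) → ⟦ d ⟧ ≡ + 1
⟦⟧-yes p (yes _) = refl
⟦⟧-yes p (no ¬p) = ⊥-elim (¬p p)

⟦⟧-no : {P : Set} → ¬ P → (d : Dec P) → ⟦ d ⟧ ≡ + 0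
⟦⟧-no ¬p (yes p) = ⊥-elim (¬p p)
⟦⟧-no ¬p (no _)  = refl

⟦⟧-⇔ : {P Q : Set} → (P → Q) → (Q → P) → (d : Dec P) (d′ : Dec Q) → ⟦ d ⟧ ≡ ⟦ d′ ⟧
⟦⟧-⇔ to from (yes p) d′ = sym (⟦⟧-yes (to p) d′)
⟦⟧-⇔ to from (no ¬p) d′ = sym (⟦⟧-no (¬p ∘ from) d′)

⟦⟧-× : {P Q R : Set} → (R → P × Q) → (P → Q → R) →
       (dR : Dec R) (dP : Dec P) (dQ : Dec Q) → ⟦ dR ⟧ ≡ ⟦ dP ⟧ * ⟦ dQ ⟧
⟦⟧-× split join dR (yes p) (yes q) = ⟦⟧-yes (join p q) dR
⟦⟧-× split join dR (yes p) (no ¬q) = ⟦⟧-no (¬q ∘ proj₂ ∘ split) dR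
⟦⟧-× split join dR (no ¬p) dQ      = ⟦⟧-no (¬p ∘ proj₁ ∘ split) dR

∑ : {A : Set} → List A → (A → ℤ) → ℤ
∑ []       f = + 0
∑ (x ∷ xs) f = f x + ∑ xs f

infixr 5 ∑
syntax ∑ xs (λ x → e) = ∑[ x ∈ xs ] e

private
  variable
    A C : Set

∑-cong : (xs : List A) {f g : A → ℤ} → (∀ x → f x ≡ g x) → ∑ xs f ≡ ∑ xs g
∑-cong []       f≗g = refl
∑-cong (x ∷ xs) f≗g = cong₂ _+_ (f≗g x) (∑-cong xs f≗g)

∑-zero : (xs : List A) → ∑[ x ∈ xs ] + 0 ≡ + 0
∑-zero []       = refl
∑-zero (x ∷ xs) = trans (ℤP.+-identityˡ _) (∑-zero xs)

∑-++ : (xs ys : List A) (f : A → ℤ) → ∑ (xs ++ ys) f ≡ ∑ xs f + ∑ ys f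
∑-++ []       ys f = sym (ℤP.+-identityˡ _)
∑-++ (x ∷ xs) ys f = trans (cong (_+_ (f x)) (∑-++ xs ys f)) (sym (ℤP.+-assoc (f x) _ _))

∑-concatMap : (h : A → List C) (xs : List A) (f : C → ℤ) →
              ∑ (concatMap h xs) f ≡ ∑[ x ∈ xs ] ∑ (h x) f
∑-concatMap h []       f = refl
∑-concatMap h (x ∷ xs) f = trans (∑-++ (h x) _ f) (cong (_+_ (∑ (h x) f)) (∑-concatMap h xs f))

∑-map : (h : A → C) (xs : List A) (f : C → ℤ) → ∑ (map h xs) f ≡ ∑ xs (f ∘ h)
∑-map h []       f = refl
∑-map h (x ∷ xs) f = cong (_+_ (f (h x))) (∑-map h xs f)

∑-filter : (p : A → Bool) (xs : List A) (f : A → ℤ) →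
           ∑ (filterᵇ p xs) f ≡ ∑[ x ∈ xs ] (if p x then f x else + 0)
∑-filter p []       f = refl
∑-filter p (x ∷ xs) f with p x
... | true  = cong (_+_ (f x)) (∑-filter p xs f)
... | false = sym (trans (ℤP.+-identityˡ _) (sym (∑-filter p xs f)))

length-filter : (p : A → Bool) (xs : List A) → + length (filterᵇ p xs) ≡ ∑[ x ∈ xs ] 𝟙 (p x)
length-filter p []       = refl
length-filter p (x ∷ xs) with p x
... | true  = cong (_+_ (+ 1)) (length-filter p xs)
... | false = trans (length-filter p xs) (sym (ℤP.+-identityˡ _))

∑-+ : (xs : List A) (f g : A → ℤ) → ∑[ x ∈ xs ] (f x + g x) ≡ ∑ xs f + ∑ xs g
∑-+ []       f g = refl
∑-+ (x ∷ xs) f g = trans (cong (_+_ (f x + g x)) (∑-+ xs f g)) (interchange (f x) (g x) _ _)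
  where
  interchange : ∀ a b c d → (a + b) + (c + d) ≡ (a + c) + (b + d)
  interchange = solve-∀

∑-neg : (xs : List A) (f : A → ℤ) → ∑[ x ∈ xs ] - f x ≡ - ∑ xs f
∑-neg []       f = refl
∑-neg (x ∷ xs) f = trans (cong (_+_ (- f x)) (∑-neg xs f)) (sym (ℤP.neg-distrib-+ (f x) _))

∑-*ˡ : (c : ℤ) (xs : List A) (f : A → ℤ) → ∑[ x ∈ xs ] c * f x ≡ c * ∑ xs f
∑-*ˡ c []       f = sym (ℤP.*-zeroʳ c)
∑-*ˡ c (x ∷ xs) f = trans (cong (_+_ (c * f x)) (∑-*ˡ c xs f)) (sym (ℤP.*-distribˡ-+ c (f x) _))

∑-*ʳ : (c : ℤ) (xs : List A) (f : A → ℤ) → ∑[ x ∈ xs ] f x * c ≡ ∑ xs f * c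
∑-*ʳ c xs f = trans (∑-cong xs (λ x → ℤP.*-comm (f x) c)) (trans (∑-*ˡ c xs f) (ℤP.*-comm c _))

∑-swap : (xs : List A) (ys : List C) (f : A → C → ℤ) →
         ∑[ x ∈ xs ] ∑[ y ∈ ys ] f x y ≡ ∑[ y ∈ ys ] ∑[ x ∈ xs ] f x y
∑-swap []       ys f = sym (∑-zero ys)
∑-swap (x ∷ xs) ys f =
  trans (cong (_+_ (∑ ys (f x))) (∑-swap xs ys f)) (sym (∑-+ ys (f x) (λ y → ∑[ x ∈ xs ] f x y)))

-- xs lists every element exactly once: summing g against the indicator of
-- y picks out g y, for every decision procedure of equality.
Enumerates : {A : Set} → List A → Set
Enumerates {A} xs = ∀ (_≟_ : DecidableEquality A) (g : A → ℤ) y → ∑[ x ∈ xs ] g x * ⟦ x ≟ y ⟧ ≡ g y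

allFin-suc : ∀ n → allFin (suc n) ≡ Fin.zero ∷ map Fin.suc (allFin n)
allFin-suc n = cong (Fin.zero ∷_) (sym (ListP.map-tabulate (λ i → i) Fin.suc))

∑-allFin-suc : ∀ n (f : Fin (suc n) → ℤ) →
               ∑ (allFin (suc n)) f ≡ f Fin.zero + (∑[ i ∈ allFin n ] f (Fin.suc i))
∑-allFin-suc n f =
  trans (cong (λ xs → ∑ xs f) (allFin-suc n)) (cong (_+_ (f Fin.zero)) (∑-map Fin.suc (allFin n) f))

enum-allFin : ∀ n → Enumerates (allFin n)
enum-allFin zero _≟_ g ()
enum-allFin (suc n) _≟_ g y = trans (∑-allFin-suc n (λ x → g x * ⟦ x ≟ y ⟧)) (split y)
  where
  open ≡-Reasoning
  split : ∀ y → g Fin.zero * ⟦ Fin.zero ≟ y ⟧ + (∑[ x ∈ allFin n ] g (Fin.suc x) * ⟦ Fin.suc x ≟ y ⟧)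
                ≡ g y
  split Fin.zero = begin
    g Fin.zero * ⟦ Fin.zero ≟ Fin.zero ⟧ + (∑[ x ∈ allFin n ] g (Fin.suc x) * ⟦ Fin.suc x ≟ Fin.zero ⟧)
      ≡⟨ cong₂ (λ a b → g Fin.zero * a + b) (⟦⟧-yes refl (Fin.zero ≟ Fin.zero))
               (∑-cong (allFin n) (λ x → cong (g (Fin.suc x) *_) (⟦⟧-no (λ ()) (Fin.suc x ≟ Fin.zero)))) ⟩
    g Fin.zero * + 1 + (∑[ x ∈ allFin n ] g (Fin.suc x) * + 0)
      ≡⟨ cong₂ _+_ (ℤP.*-identityʳ (g Fin.zero))
               (trans (∑-cong (allFin n) (λ x → ℤP.*-zeroʳ (g (Fin.suc x)))) (∑-zero (allFin n))) ⟩
    g Fin.zero + + 0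
      ≡⟨ ℤP.+-identityʳ _ ⟩
    g Fin.zero ∎
  split (Fin.suc y) = begin
    g Fin.zero * ⟦ Fin.zero ≟ Fin.suc y ⟧ + (∑[ x ∈ allFin n ] g (Fin.suc x) * ⟦ Fin.suc x ≟ Fin.suc y ⟧)
      ≡⟨ cong₂ (λ a b → g Fin.zero * a + b) (⟦⟧-no (λ ()) (Fin.zero ≟ Fin.suc y))
               (∑-cong (allFin n) (λ x → cong (g (Fin.suc x) *_)
                 (⟦⟧-⇔ FinP.suc-injective (cong Fin.suc) (Fin.suc x ≟ Fin.suc y) (x ≟ᶠ y)))) ⟩
    g Fin.zero * + 0 + (∑[ x ∈ allFin n ] g (Fin.suc x) * ⟦ x ≟ᶠ y ⟧)
      ≡⟨ trans (cong (_+ (∑[ x ∈ allFin n ] g (Fin.suc x) * ⟦ x ≟ᶠ y ⟧)) (ℤP.*-zeroʳ (g Fin.zero)))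
               (ℤP.+-identityˡ _) ⟩
    ∑[ x ∈ allFin n ] g (Fin.suc x) * ⟦ x ≟ᶠ y ⟧
      ≡⟨ enum-allFin n _≟ᶠ_ (g ∘ Fin.suc) y ⟩
    g (Fin.suc y) ∎

enum-pairs : {A E T : Set} (c : A → E → T) →
             (∀ {a b a′ b′} → c a b ≡ c a′ b′ → a ≡ a′ × b ≡ b′) →
             DecidableEquality A → DecidableEquality E →
             (xs : List A) (ys : List E) → Enumerates xs → Enumerates ys →
             (_≟_ : DecidableEquality T) (g : T → ℤ) (a′ : A) (b′ : E) →
             ∑[ t ∈ concatMap (λ a → map (c a) ys) xs ] g t * ⟦ t ≟ c a′ b′ ⟧ ≡ g (c a′ b′)
enum-pairs {T = T} c c-injective _≟A_ _≟E_ xs ys enum-xs enum-ys _≟_ g a′ b′ = begin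
    ∑[ t ∈ concatMap (λ a → map (c a) ys) xs ] term t
      ≡⟨ ∑-concatMap (λ a → map (c a) ys) xs term ⟩
    ∑[ a ∈ xs ] ∑ (map (c a) ys) term
      ≡⟨ ∑-cong xs (λ a → trans (∑-map (c a) ys term) (∑-cong ys (factor a))) ⟩
    ∑[ a ∈ xs ] ∑[ b ∈ ys ] (g (c a b) * ⟦ b ≟E b′ ⟧) * ⟦ a ≟A a′ ⟧
      ≡⟨ ∑-cong xs (λ a → ∑-*ʳ ⟦ a ≟A a′ ⟧ ys (λ b → g (c a b) * ⟦ b ≟E b′ ⟧)) ⟩
    ∑[ a ∈ xs ] (∑[ b ∈ ys ] g (c a b) * ⟦ b ≟E b′ ⟧) * ⟦ a ≟A a′ ⟧
      ≡⟨ ∑-cong xs (λ a → cong (_* ⟦ a ≟A a′ ⟧) (enum-ys _≟E_ (g ∘ c a) b′)) ⟩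
    ∑[ a ∈ xs ] g (c a b′) * ⟦ a ≟A a′ ⟧
      ≡⟨ enum-xs _≟A_ (λ a → g (c a b′)) a′ ⟩
    g (c a′ b′) ∎
  where
  open ≡-Reasoning
  term : T → ℤ
  term t = g t * ⟦ t ≟ c a′ b′ ⟧
  reassoc : ∀ x p q → x * (p * q) ≡ (x * q) * p
  reassoc = solve-∀
  factor : ∀ a b → term (c a b) ≡ (g (c a b) * ⟦ b ≟E b′ ⟧) * ⟦ a ≟A a′ ⟧
  factor a b = trans (cong (g (c a b) *_)
                        (⟦⟧-× c-injective (cong₂ c) (c a b ≟ c a′ b′) (a ≟A a′) (b ≟E b′)))
                     (reassoc (g (c a b)) _ _)

enum-allVecs : {A : Set} → DecidableEquality A → (xs : List A) → Enumerates xs →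
               ∀ k → Enumerates (allVecs xs k)
enum-allVecs _≟A_ xs enum zero _≟_ g [] =
  trans (ℤP.+-identityʳ _) (trans (cong (g [] *_) (⟦⟧-yes refl ([] ≟ []))) (ℤP.*-identityʳ (g [])))
enum-allVecs _≟A_ xs enum (suc k) _≟_ g (y ∷ w) =
  enum-pairs _∷_ (λ eq → VecP.∷-injectiveˡ eq , VecP.∷-injectiveʳ eq) _≟A_ (VecP.≡-dec _≟A_)
             xs (allVecs xs k) enum (enum-allVecs _≟A_ xs enum k) _≟_ g y w

_≟E_ : ∀ {n} → DecidableEquality (Edge n)
_≟E_ = ×P.≡-dec _≟ᶠ_ _≟ᶠ_

enum-allGraphs : ∀ n k → Enumerates (allGraphs n k)
enum-allGraphs n = enum-allVecs _≟E_ (allEdges n) enum-allEdges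
  where
  enum-allEdges : Enumerates (allEdges n)
  enum-allEdges _≟_ g (a , b) =
    enum-pairs _,_ ×P.,-injective _≟ᶠ_ _≟ᶠ_ (allFin n) (allFin n) (enum-allFin n) (enum-allFin n) _≟_ g a b

∑-involution : {A : Set} (xs : List A) → Enumerates xs → DecidableEquality A →
               (σ : A → A) → (∀ x → σ (σ x) ≡ x) → (g : A → ℤ) →
               ∑[ x ∈ xs ] g (σ x) ≡ ∑ xs g
∑-involution xs enum _≟_ σ σσ g = begin
    ∑[ x ∈ xs ] g (σ x)
      ≡⟨ ∑-cong xs (λ x → sym (enum _≟_ g (σ x))) ⟩
    ∑[ x ∈ xs ] ∑[ y ∈ xs ] g y * ⟦ y ≟ σ x ⟧
      ≡⟨ ∑-swap xs xs _ ⟩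
    ∑[ y ∈ xs ] ∑[ x ∈ xs ] g y * ⟦ y ≟ σ x ⟧
      ≡⟨ ∑-cong xs (λ y → ∑-*ˡ (g y) xs _) ⟩
    ∑[ y ∈ xs ] g y * (∑[ x ∈ xs ] ⟦ y ≟ σ x ⟧)
      ≡⟨ ∑-cong xs (λ y → cong (g y *_)
                              (trans (∑-cong xs (swap-sides y)) (enum _≟_ (λ _ → + 1) (σ y)))) ⟩
    ∑[ y ∈ xs ] g y * + 1
      ≡⟨ ∑-cong xs (λ y → ℤP.*-identityʳ (g y)) ⟩
    ∑ xs g ∎
  where
  open ≡-Reasoning
  swap-sides : ∀ y x → ⟦ y ≟ σ x ⟧ ≡ + 1 * ⟦ x ≟ σ y ⟧
  swap-sides y x = trans (⟦⟧-⇔ (λ y≡σx → trans (sym (σσ x)) (cong σ (sym y≡σx)))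
                               (λ x≡σy → trans (sym (σσ y)) (cong σ (sym x≡σy)))
                               (y ≟ σ x) (x ≟ σ y))
                         (sym (ℤP.*-identityˡ _))

δ : ∀ {n k} → Graph n k → Graph n k → ℤ
δ G H = ⟦ G ≟G H ⟧

coeff-∑ : ∀ {n k} (H : Graph n k) (X : LinComb n k) →
          coeff H X ≡ ∑[ t ∈ X ] proj₁ t * δ (proj₂ t) H
coeff-∑ H []             = refl
coeff-∑ H ((c , G) ∷ X) with G ≟G H
... | yes _ = cong₂ _+_ (sym (ℤP.*-identityʳ c)) (coeff-∑ H X)
... | no _  = sym (trans (cong (_+ _) (ℤP.*-zeroʳ c)) (trans (ℤP.+-identityˡ _) (sym (coeff-∑ H X))))

coeff-tabulated : ∀ n k (χ : Graph n k → ℤ) (H : Graph n k) →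
                  coeff H (map (λ G → (χ G , G)) (allGraphs n k)) ≡ χ H
coeff-tabulated n k χ H =
  trans (coeff-∑ H (map (λ G → (χ G , G)) (allGraphs n k)))
        (trans (∑-map (λ G → (χ G , G)) (allGraphs n k) (λ t → proj₁ t * δ (proj₂ t) H))
               (enum-allGraphs n k _≟G_ χ H))

∂ : ∀ {n} → (Edge n → ℤ) → Edge n → ℤ
∂ ψ (p , r) with p ≟ᶠ r
... | yes _ = + 0
... | no _  = ψ (p , r) - ψ (p , p)

module _ {n : ℕ} where

  ∂-cong : {ψ ψ′ : Edge n → ℤ} → (∀ e → ψ e ≡ ψ′ e) → ∀ h → ∂ ψ h ≡ ∂ ψ′ h
  ∂-cong ψ≗ψ′ (p , r) with p ≟ᶠ r
  ... | yes _ = refl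
  ... | no _  = cong₂ _-_ (ψ≗ψ′ (p , r)) (ψ≗ψ′ (p , p))

  ∂-*ˡ : (c : ℤ) (ψ : Edge n → ℤ) → ∀ h → ∂ (λ e → c * ψ e) h ≡ c * ∂ ψ h
  ∂-*ˡ c ψ (p , r) with p ≟ᶠ r
  ... | yes _ = sym (ℤP.*-zeroʳ c)
  ... | no _  = distrib c (ψ (p , r)) (ψ (p , p))
    where
    distrib : ∀ c a b → c * a - c * b ≡ c * (a - b)
    distrib = solve-∀

  ∂-*ʳ : (c : ℤ) (ψ : Edge n → ℤ) → ∀ h → ∂ (λ e → ψ e * c) h ≡ ∂ ψ h * c
  ∂-*ʳ c ψ h = trans (∂-cong (λ e → ℤP.*-comm (ψ e) c) h) (trans (∂-*ˡ c ψ h) (ℤP.*-comm c _))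

  ∂-∑ : (xs : List A) (ψ : A → Edge n → ℤ) →
        ∀ h → ∂ (λ e → ∑[ a ∈ xs ] ψ a e) h ≡ ∑[ a ∈ xs ] ∂ (ψ a) h
  ∂-∑ xs ψ (p , r) with p ≟ᶠ r
  ... | yes _ = sym (∑-zero xs)
  ... | no _  = sym (trans (∑-+ xs (λ a → ψ a (p , r)) (λ a → - ψ a (p , p)))
                           (cong (_+_ (∑[ a ∈ xs ] ψ a (p , r))) (∑-neg xs (λ a → ψ a (p , p)))))

-- The transpose of B_i, acting on coefficient functions: only the i-th edge
-- of H is varied (coeff-B shows it computes the coefficients of B_i X).
Bᵀ : ∀ {n k} → Fin k → (Graph n k → ℤ) → Graph n k → ℤ
Bᵀ i φ H = ∂ (λ e → φ (H [ i ]≔ e)) (lookup H i)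

module _ {A : Set} {k : ℕ} (i : Fin k) (G H : Vec A k) where

  reupdate : ∀ {x y z} → G [ i ]≔ x ≡ H [ i ]≔ y → G [ i ]≔ z ≡ H [ i ]≔ z
  reupdate {z = z} eq =
    trans (sym (VecP.[]≔-idempotent G i)) (trans (cong (_[ i ]≔ z) eq) (VecP.[]≔-idempotent H i))

  updated-entries : ∀ {x y} → G [ i ]≔ x ≡ H [ i ]≔ y → x ≡ y
  updated-entries {x} {y} eq =
    trans (sym (VecP.lookup∘update i G x)) (trans (cong (λ V → lookup V i) eq) (VecP.lookup∘update i H y))

δ-updates : ∀ {n k} (i : Fin k) (G H : Graph n k) (x y z : Edge n) →
            δ (G [ i ]≔ x) (H [ i ]≔ y) ≡ ⟦ x ≟E y ⟧ * δ (G [ i ]≔ z) (H [ i ]≔ z)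
δ-updates i G H x y z =
  ⟦⟧-× (λ eq → updated-entries i G H eq , reupdate i G H eq) (λ { refl eq → reupdate i G H eq })
       ((G [ i ]≔ x) ≟G (H [ i ]≔ y)) (x ≟E y) ((G [ i ]≔ z) ≟G (H [ i ]≔ z))

-- With g the i-th edge of G, the factor δ G (H [ i ]≔ g) records whether G
-- and H agree away from edge i.
module _ {n k : ℕ} (i : Fin k) (G H : Graph n k) {g : Edge n} (Gᵢ≡g : lookup G i ≡ g) where

  private
    G[i]≔g≡G : G [ i ]≔ g ≡ G
    G[i]≔g≡G = trans (cong (G [ i ]≔_) (sym Gᵢ≡g)) (VecP.[]≔-lookup G i)

  δ-replaceˡ : ∀ e → δ (G [ i ]≔ e) H ≡ ⟦ e ≟E lookup H i ⟧ * δ G (H [ i ]≔ g)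
  δ-replaceˡ e = begin
      δ (G [ i ]≔ e) H
        ≡⟨ cong (δ (G [ i ]≔ e)) (sym (VecP.[]≔-lookup H i)) ⟩
      δ (G [ i ]≔ e) (H [ i ]≔ lookup H i)
        ≡⟨ δ-updates i G H e (lookup H i) g ⟩
      ⟦ e ≟E lookup H i ⟧ * δ (G [ i ]≔ g) (H [ i ]≔ g)
        ≡⟨ cong (λ G′ → ⟦ e ≟E lookup H i ⟧ * δ G′ (H [ i ]≔ g)) G[i]≔g≡G ⟩
      ⟦ e ≟E lookup H i ⟧ * δ G (H [ i ]≔ g) ∎
    where open ≡-Reasoning

  δ-replaceʳ : ∀ e → δ G (H [ i ]≔ e) ≡ ⟦ g ≟E e ⟧ * δ G (H [ i ]≔ g)
  δ-replaceʳ e = begin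
      δ G (H [ i ]≔ e)
        ≡⟨ cong (λ G′ → δ G′ (H [ i ]≔ e)) (sym G[i]≔g≡G) ⟩
      δ (G [ i ]≔ g) (H [ i ]≔ e)
        ≡⟨ δ-updates i G H g e g ⟩
      ⟦ g ≟E e ⟧ * δ (G [ i ]≔ g) (H [ i ]≔ g)
        ≡⟨ cong (λ G′ → ⟦ g ≟E e ⟧ * δ G′ (H [ i ]≔ g)) G[i]≔g≡G ⟩
      ⟦ g ≟E e ⟧ * δ G (H [ i ]≔ g) ∎
    where open ≡-Reasoning

  δ-split : δ G H ≡ ⟦ g ≟E lookup H i ⟧ * δ G (H [ i ]≔ g)
  δ-split = trans (cong (δ G) (sym (VecP.[]≔-lookup H i))) (δ-replaceʳ (lookup H i))

non-loop : ∀ {n} {a b p : Fin n} → ¬ a ≡ b → ¬ (a , b) ≡ (p , p)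
non-loop a≢b eq = a≢b (trans (cong proj₁ eq) (sym (cong proj₂ eq)))

edgeB : ∀ {n} → Edge n → Edge n → ℤ
edgeB {n} (a , b) h with a ≟ᶠ b
... | no _  = ⟦ (a , b) ≟E h ⟧
... | yes _ = - (∑[ m ∈ filterᵇ (λ m → not (does (m ≟ᶠ a))) (allFin n) ] ⟦ (a , m) ≟E h ⟧)

-- Since B_i only changes the i-th edge, its coefficients factor.
coeff-Bbasis : ∀ {n k} (i : Fin k) (G H : Graph n k) →
               coeff H (Bbasis i G) ≡ edgeB (lookup G i) (lookup H i) * δ G (H [ i ]≔ lookup G i)
coeff-Bbasis {n} i G H with lookup G i in Gᵢ≡g
... | (a , b) with a ≟ᶠ b
...   | no _ = begin
        coeff H ((+ 1 , G) ∷ [])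
          ≡⟨ coeff-∑ H ((+ 1 , G) ∷ []) ⟩
        + 1 * δ G H + + 0
          ≡⟨ trans (ℤP.+-identityʳ _) (ℤP.*-identityˡ _) ⟩
        δ G H
          ≡⟨ δ-split i G H Gᵢ≡g ⟩
        ⟦ (a , b) ≟E lookup H i ⟧ * δ G (H [ i ]≔ (a , b)) ∎
  where open ≡-Reasoning
...   | yes refl = begin
        coeff H (map (λ m → (- (+ 1) , R a m i G)) others)
          ≡⟨ coeff-∑ H (map (λ m → (- (+ 1) , R a m i G)) others) ⟩
        ∑ (map (λ m → (- (+ 1) , R a m i G)) others) (λ t → proj₁ t * δ (proj₂ t) H)
          ≡⟨ ∑-map (λ m → (- (+ 1) , R a m i G)) others (λ t → proj₁ t * δ (proj₂ t) H) ⟩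
        ∑[ m ∈ others ] - (+ 1) * δ (G [ i ]≔ (a , m)) H
          ≡⟨ ∑-cong others (λ m → trans (cong (- (+ 1) *_) (δ-replaceˡ i G H Gᵢ≡g (a , m)))
                                        (move-sign ⟦ (a , m) ≟E lookup H i ⟧ rest)) ⟩
        ∑[ m ∈ others ] ⟦ (a , m) ≟E lookup H i ⟧ * - rest
          ≡⟨ ∑-*ʳ (- rest) others (λ m → ⟦ (a , m) ≟E lookup H i ⟧) ⟩
        (∑[ m ∈ others ] ⟦ (a , m) ≟E lookup H i ⟧) * - rest
          ≡⟨ move-sign′ (∑[ m ∈ others ] ⟦ (a , m) ≟E lookup H i ⟧) rest ⟩
        - (∑[ m ∈ others ] ⟦ (a , m) ≟E lookup H i ⟧) * rest ∎
  where
  open ≡-Reasoning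
  others : List (Fin n)
  others = filterᵇ (λ m → not (does (m ≟ᶠ a))) (allFin n)
  rest : ℤ
  rest = δ G (H [ i ]≔ (a , a))
  move-sign : ∀ x y → - (+ 1) * (x * y) ≡ x * - y
  move-sign = solve-∀
  move-sign′ : ∀ x y → x * - y ≡ - x * y
  move-sign′ = solve-∀

-- The edge-level identity behind the Laplacian: B_i acts on the i-th edge
-- as the transpose of ∂.
edgeB-∂ : ∀ {n} (g h : Edge n) → edgeB g h ≡ ∂ (λ e → ⟦ g ≟E e ⟧) h
edgeB-∂ {n} (a , b) (p , r) with a ≟ᶠ b | p ≟ᶠ r
... | no a≢b | yes refl = ⟦⟧-no (non-loop a≢b) ((a , b) ≟E (p , p))
... | no a≢b | no _ =
  sym (trans (cong (_-_ ⟦ (a , b) ≟E (p , r) ⟧) (⟦⟧-no (non-loop a≢b) ((a , b) ≟E (p , p))))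
             (ℤP.+-identityʳ _))
... | yes refl | yes refl =
  cong -_ (trans (∑-filter _ (allFin n) _) (trans (∑-cong (allFin n) no-loop) (∑-zero (allFin n))))
  where
  no-loop : ∀ m → (if not (does (m ≟ᶠ a)) then ⟦ (a , m) ≟E (p , p) ⟧ else + 0) ≡ + 0
  no-loop m with m ≟ᶠ a
  ... | yes _  = refl
  ... | no m≢a = ⟦⟧-no (non-loop (m≢a ∘ sym)) ((a , m) ≟E (p , p))
... | yes refl | no p≢r = begin
    - (∑[ m ∈ filterᵇ (λ m → not (does (m ≟ᶠ a))) (allFin n) ] ⟦ (a , m) ≟E (p , r) ⟧)
      ≡⟨ cong -_ (∑-filter _ (allFin n) _) ⟩
    - (∑[ m ∈ allFin n ] (if not (does (m ≟ᶠ a)) then ⟦ (a , m) ≟E (p , r) ⟧ else + 0))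
      ≡⟨ cong -_ (∑-cong (allFin n) factor) ⟩
    - (∑[ m ∈ allFin n ] ⟦ a ≟ᶠ p ⟧ * ⟦ m ≟ᶠ r ⟧)
      ≡⟨ cong -_ (enum-allFin n _≟ᶠ_ (λ _ → ⟦ a ≟ᶠ p ⟧) r) ⟩
    - ⟦ a ≟ᶠ p ⟧
      ≡⟨ sym (ℤP.+-identityˡ _) ⟩
    + 0 - ⟦ a ≟ᶠ p ⟧
      ≡⟨ cong₂ _-_ (sym (loop≢edge ((a , a) ≟E (p , r))))
                   (⟦⟧-⇔ (λ a≡p → cong₂ _,_ a≡p a≡p) (cong proj₁) (a ≟ᶠ p) ((a , a) ≟E (p , p))) ⟩
    ⟦ (a , a) ≟E (p , r) ⟧ - ⟦ (a , a) ≟E (p , p) ⟧ ∎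
  where
  open ≡-Reasoning
  loop≢edge : (d : Dec ((a , a) ≡ (p , r))) → ⟦ d ⟧ ≡ + 0
  loop≢edge = ⟦⟧-no (non-loop p≢r ∘ sym)
  pair : ∀ m → ⟦ (a , m) ≟E (p , r) ⟧ ≡ ⟦ a ≟ᶠ p ⟧ * ⟦ m ≟ᶠ r ⟧
  pair m = ⟦⟧-× ×P.,-injective (cong₂ _,_) ((a , m) ≟E (p , r)) (a ≟ᶠ p) (m ≟ᶠ r)
  factor : ∀ m → (if not (does (m ≟ᶠ a)) then ⟦ (a , m) ≟E (p , r) ⟧ else + 0)
                 ≡ ⟦ a ≟ᶠ p ⟧ * ⟦ m ≟ᶠ r ⟧
  factor m with m ≟ᶠ a
  ... | yes refl = sym (trans (sym (pair a)) (loop≢edge ((a , a) ≟E (p , r))))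
  ... | no _     = pair m

coeff-Bbasis-Bᵀ : ∀ {n k} (i : Fin k) (G H : Graph n k) → coeff H (Bbasis i G) ≡ Bᵀ i (δ G) H
coeff-Bbasis-Bᵀ i G H = begin
    coeff H (Bbasis i G)
      ≡⟨ coeff-Bbasis i G H ⟩
    edgeB (lookup G i) (lookup H i) * agree
      ≡⟨ cong (_* agree) (edgeB-∂ (lookup G i) (lookup H i)) ⟩
    ∂ (λ e → ⟦ lookup G i ≟E e ⟧) (lookup H i) * agree
      ≡⟨ sym (∂-*ʳ agree (λ e → ⟦ lookup G i ≟E e ⟧) (lookup H i)) ⟩
    ∂ (λ e → ⟦ lookup G i ≟E e ⟧ * agree) (lookup H i)
      ≡⟨ ∂-cong (λ e → sym (δ-replaceʳ i G H refl e)) (lookup H i) ⟩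
    Bᵀ i (δ G) H ∎
  where
  open ≡-Reasoning
  agree : ℤ
  agree = δ G (H [ i ]≔ lookup G i)

coeff-scale : ∀ {n k} (H : Graph n k) (c : ℤ) (X : LinComb n k) → coeff H (scale c X) ≡ c * coeff H X
coeff-scale {n} {k} H c X = begin
    coeff H (scale c X)
      ≡⟨ coeff-∑ H (scale c X) ⟩
    ∑ (scale c X) term
      ≡⟨ ∑-map _ X term ⟩
    ∑[ t ∈ X ] (c * proj₁ t) * δ (proj₂ t) H
      ≡⟨ ∑-cong X (λ t → ℤP.*-assoc c (proj₁ t) (δ (proj₂ t) H)) ⟩
    ∑[ t ∈ X ] c * term t
      ≡⟨ ∑-*ˡ c X term ⟩
    c * ∑ X term
      ≡⟨ cong (c *_) (sym (coeff-∑ H X)) ⟩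
    c * coeff H X ∎
  where
  open ≡-Reasoning
  term : ℤ × Graph n k → ℤ
  term t = proj₁ t * δ (proj₂ t) H

coeff-B : ∀ {n k} (i : Fin k) (X : LinComb n k) (H : Graph n k) →
          coeff H (B i X) ≡ Bᵀ i (λ G → coeff G X) H
coeff-B i X H = begin
    coeff H (B i X)
      ≡⟨ coeff-∑ H (B i X) ⟩
    ∑ (B i X) (λ t → proj₁ t * δ (proj₂ t) H)
      ≡⟨ ∑-concatMap _ X (λ t → proj₁ t * δ (proj₂ t) H) ⟩
    ∑[ t ∈ X ] ∑ (scale (proj₁ t) (Bbasis i (proj₂ t))) (λ s → proj₁ s * δ (proj₂ s) H)
      ≡⟨ ∑-cong X (λ t → sym (coeff-∑ H (scale (proj₁ t) (Bbasis i (proj₂ t))))) ⟩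
    ∑[ t ∈ X ] coeff H (scale (proj₁ t) (Bbasis i (proj₂ t)))
      ≡⟨ ∑-cong X (λ t → coeff-scale H (proj₁ t) (Bbasis i (proj₂ t))) ⟩
    ∑[ t ∈ X ] proj₁ t * coeff H (Bbasis i (proj₂ t))
      ≡⟨ ∑-cong X (λ t → cong (proj₁ t *_) (coeff-Bbasis-Bᵀ i (proj₂ t) H)) ⟩
    ∑[ t ∈ X ] proj₁ t * Bᵀ i (δ (proj₂ t)) H
      ≡⟨ sym (∑-cong X (λ t → ∂-*ˡ (proj₁ t) (λ e → δ (proj₂ t) (H [ i ]≔ e)) (lookup H i))) ⟩
    ∑[ t ∈ X ] Bᵀ i (λ G → proj₁ t * δ (proj₂ t) G) H
      ≡⟨ sym (∂-∑ X (λ t e → proj₁ t * δ (proj₂ t) (H [ i ]≔ e)) (lookup H i)) ⟩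
    Bᵀ i (λ G → ∑[ t ∈ X ] proj₁ t * δ (proj₂ t) G) H
      ≡⟨ sym (∂-cong (λ e → coeff-∑ (H [ i ]≔ e) X) (lookup H i)) ⟩
    Bᵀ i (λ G → coeff G X) H ∎
  where open ≡-Reasoning

coeff-foldr-B : ∀ {n k} (is : List (Fin k)) (X : LinComb n k) (H : Graph n k) →
                coeff H (foldr B X is) ≡ foldr Bᵀ (λ G → coeff G X) is H
coeff-foldr-B []       X H = refl
coeff-foldr-B (i ∷ is) X H =
  trans (coeff-B i (foldr B X is) H) (∂-cong (λ e → coeff-foldr-B is X (H [ i ]≔ e)) (lookup H i))

module _ {n k : ℕ} where

  foldr-Bᵀ-cong : (is : List (Fin k)) {φ ψ : Graph n k → ℤ} → (∀ G → φ G ≡ ψ G) →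
                  ∀ H → foldr Bᵀ φ is H ≡ foldr Bᵀ ψ is H
  foldr-Bᵀ-cong []       φ≗ψ H = φ≗ψ H
  foldr-Bᵀ-cong (i ∷ is) φ≗ψ H = ∂-cong (λ e → foldr-Bᵀ-cong is φ≗ψ (H [ i ]≔ e)) (lookup H i)

  foldr-Bᵀ-*ˡ : (is : List (Fin k)) (c : ℤ) (φ : Graph n k → ℤ) →
                ∀ H → foldr Bᵀ (λ G → c * φ G) is H ≡ c * foldr Bᵀ φ is H
  foldr-Bᵀ-*ˡ []       c φ H = refl
  foldr-Bᵀ-*ˡ (i ∷ is) c φ H =
    trans (∂-cong (λ e → foldr-Bᵀ-*ˡ is c φ (H [ i ]≔ e)) (lookup H i))
          (∂-*ˡ c (λ e → foldr Bᵀ φ is (H [ i ]≔ e)) (lookup H i))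

  foldr-Bᵀ-∑ : (is : List (Fin k)) (xs : List A) (ψ : A → Graph n k → ℤ) →
               ∀ H → foldr Bᵀ (λ G → ∑[ a ∈ xs ] ψ a G) is H ≡ ∑[ a ∈ xs ] foldr Bᵀ (ψ a) is H
  foldr-Bᵀ-∑ []       xs ψ H = refl
  foldr-Bᵀ-∑ (i ∷ is) xs ψ H =
    trans (∂-cong (λ e → foldr-Bᵀ-∑ is xs ψ (H [ i ]≔ e)) (lookup H i))
          (∂-∑ xs (λ a e → foldr Bᵀ (ψ a) is (H [ i ]≔ e)) (lookup H i))

foldr-Bᵀ-shift : ∀ {n k} (is : List (Fin k)) (φ : Graph n (suc k) → ℤ) (e : Edge n) (G : Graph n k) →
                 foldr Bᵀ φ (map Fin.suc is) (e ∷ G) ≡ foldr Bᵀ (λ G′ → φ (e ∷ G′)) is G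
foldr-Bᵀ-shift []       φ e G = refl
foldr-Bᵀ-shift (i ∷ is) φ e G = ∂-cong (λ x → foldr-Bᵀ-shift is φ e (G [ i ]≔ x)) (lookup G i)

∏ : ∀ {n k} → (Edge n → ℤ) → Graph n k → ℤ
∏ c []      = + 1
∏ c (e ∷ G) = c e * ∏ c G

∏-cong : ∀ {n k} {c c′ : Edge n → ℤ} → (∀ e → c e ≡ c′ e) → (G : Graph n k) → ∏ c G ≡ ∏ c′ G
∏-cong c≗c′ []      = refl
∏-cong c≗c′ (e ∷ G) = cong₂ _*_ (c≗c′ e) (∏-cong c≗c′ G)

∏-neg : ∀ {n k} (c : Edge n → ℤ) (G : Graph n k) → ∏ (λ e → - c e) G ≡ sgn k * ∏ c G
∏-neg c []      = refl
∏-neg {k = suc k} c (e ∷ G) = trans (cong (- c e *_) (∏-neg c G)) (pull-sign (c e) (sgn k) (∏ c G))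
  where
  pull-sign : ∀ x s p → - x * (s * p) ≡ - s * (x * p)
  pull-sign = solve-∀

Δᵀ-∏ : ∀ {n} k (c : Edge n → ℤ) (H : Graph n k) → foldr Bᵀ (∏ c) (allFin k) H ≡ ∏ (∂ c) H
Δᵀ-∏ zero    c []      = refl
Δᵀ-∏ (suc k) c (e ∷ G) = begin
    foldr Bᵀ (∏ c) (allFin (suc k)) (e ∷ G)
      ≡⟨ cong (λ is → foldr Bᵀ (∏ c) is (e ∷ G)) (allFin-suc k) ⟩
    ∂ (λ x → foldr Bᵀ (∏ c) (map Fin.suc (allFin k)) (x ∷ G)) e
      ≡⟨ ∂-cong (λ x → foldr-Bᵀ-shift (allFin k) (∏ c) x G) e ⟩
    ∂ (λ x → foldr Bᵀ (λ G′ → c x * ∏ c G′) (allFin k) G) e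
      ≡⟨ ∂-cong (λ x → foldr-Bᵀ-*ˡ (allFin k) (c x) (∏ c) G) e ⟩
    ∂ (λ x → c x * foldr Bᵀ (∏ c) (allFin k) G) e
      ≡⟨ ∂-cong (λ x → cong (c x *_) (Δᵀ-∏ k c G)) e ⟩
    ∂ (λ x → c x * ∏ (∂ c) G) e
      ≡⟨ ∂-*ʳ (∏ (∂ c) G) c e ⟩
    ∂ c e * ∏ (∂ c) G ∎
  where open ≡-Reasoning

≤-indicator-complement : ∀ {x y} (y≤?x : Dec (y ≤ x)) (x<?y : Dec (suc x ≤ y)) →
                         ⟦ y≤?x ⟧ ≡ + 1 - ⟦ x<?y ⟧
≤-indicator-complement (yes y≤x) (yes x<y) = ⊥-elim (ℕP.<-irrefl refl (ℕP.≤-trans x<y y≤x))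
≤-indicator-complement (yes _)   (no _)    = refl
≤-indicator-complement (no _)    (yes _)   = refl
≤-indicator-complement (no y≰x)  (no x≮y)  = ⊥-elim (x≮y (ℕP.≰⇒> y≰x))

module _ {n q : ℕ} (f : Vec (Fin q) n) where

  colour : Fin n → ℕ
  colour a = toℕ (lookup f a)

  weak ascent strict : Edge n → ℤ
  weak   e = ⟦ colour (proj₂ e) ≤? colour (proj₁ e) ⟧
  ascent e = ⟦ suc (colour (proj₁ e)) ≤? colour (proj₂ e) ⟧
  strict e = ⟦ suc (colour (proj₂ e)) ≤? colour (proj₁ e) ⟧

  -- weak is 1 on loops and complementary to ascent, so ∂ weak = − ascent.
  ∂-weak : ∀ e → ∂ weak e ≡ - ascent e
  ∂-weak (p , r) with p ≟ᶠ r
  ... | yes refl = sym (cong -_ (⟦⟧-no (ℕP.<-irrefl refl) (suc (colour p) ≤? colour p)))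
  ... | no _     = begin
      weak (p , r) - weak (p , p)
        ≡⟨ cong₂ _-_ (≤-indicator-complement (colour r ≤? colour p) (suc (colour p) ≤? colour r))
                     (⟦⟧-yes ℕP.≤-refl (colour p ≤? colour p)) ⟩
      + 1 - ascent (p , r) - + 1
        ≡⟨ cancel (ascent (p , r)) ⟩
      - ascent (p , r) ∎
    where
    open ≡-Reasoning
    cancel : ∀ x → + 1 - x - + 1 ≡ - x
    cancel = solve-∀

mirror : ∀ {n q} → Vec (Fin q) n → Vec (Fin q) n
mirror = Vec.map opposite

mirror-involutive : ∀ {n q} (f : Vec (Fin q) n) → mirror (mirror f) ≡ f
mirror-involutive []      = refl
mirror-involutive (x ∷ f) = cong₂ _∷_ (FinP.opposite-involutive x) (mirror-involutive f)

opposite-reverses-< : ∀ {q} (x y : Fin q) → toℕ y < toℕ x → toℕ (opposite x) < toℕ (opposite y)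
opposite-reverses-< x y y<x =
  subst₂ _<_ (sym (FinP.opposite-prop x)) (sym (FinP.opposite-prop y))
             (ℕP.∸-monoʳ-< (s≤s y<x) (FinP.toℕ<n x))

ascent-mirror : ∀ {n q} (f : Vec (Fin q) n) e → ascent (mirror f) e ≡ strict f e
ascent-mirror {q = q} f (a , b) rewrite VecP.lookup-map a opposite f | VecP.lookup-map b opposite f =
  ⟦⟧-⇔ (λ lt → subst₂ (λ u v → toℕ u < toℕ v) (FinP.opposite-involutive fb) (FinP.opposite-involutive fa)
                   (opposite-reverses-< (opposite fb) (opposite fa) lt))
       (opposite-reverses-< fa fb)
       (suc (toℕ (opposite fa)) ≤? toℕ (opposite fb)) (suc (toℕ fb) ≤? toℕ fa)
  where
  fa fb : Fin q
  fa = lookup f a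
  fb = lookup f b

ascents≡descents : ∀ {n q k} (H : Graph n k) →
                   ∑[ f ∈ allMaps n q ] ∏ (ascent f) H ≡ ∑[ f ∈ allMaps n q ] ∏ (strict f) H
ascents≡descents {n} {q} H = begin
    ∑[ f ∈ allMaps n q ] ∏ (ascent f) H
      ≡⟨ sym (∑-involution (allMaps n q) (enum-allVecs _≟ᶠ_ (allFin q) (enum-allFin q) n)
                           (VecP.≡-dec _≟ᶠ_) mirror mirror-involutive (λ f → ∏ (ascent f) H)) ⟩
    ∑[ f ∈ allMaps n q ] ∏ (ascent (mirror f)) H
      ≡⟨ ∑-cong (allMaps n q) (λ f → ∏-cong (ascent-mirror f) H) ⟩
    ∑[ f ∈ allMaps n q ] ∏ (strict f) H ∎
  where open ≡-Reasoning

allB-∏ : ∀ {n k} (p : Edge n → Bool) (G : Graph n k) → 𝟙 (allB p G) ≡ ∏ (𝟙 ∘ p) G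
allB-∏ p []      = refl
allB-∏ p (e ∷ G) with p e
... | true  = trans (allB-∏ p G) (sym (ℤP.*-identityˡ _))
... | false = refl

count-∏ : ∀ {n k q} (ok : Vec (Fin q) n → Edge n → Bool) (G : Graph n k) →
          + length (filterᵇ (λ f → allB (ok f) G) (allMaps n q)) ≡ ∑[ f ∈ allMaps n q ] ∏ (𝟙 ∘ ok f) G
count-∏ {n} {q = q} ok G =
  trans (length-filter (λ f → allB (ok f) G) (allMaps n q))
        (∑-cong (allMaps n q) (λ f → allB-∏ (ok f) G))

coeff-𝒳≥ : ∀ {n k} (q : ℕ) (G : Graph n k) → coeff G (𝒳≥ n k q) ≡ ∑[ f ∈ allMaps n q ] ∏ (weak f) G
coeff-𝒳≥ {n} {k} q G =
  trans (coeff-tabulated n k (λ G′ → + χ≥ G′ q) G)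
        (count-∏ (λ f e → does (colour f (proj₂ e) ≤? colour f (proj₁ e))) G)

coeff-𝒳> : ∀ {n k} (q : ℕ) (G : Graph n k) → coeff G (𝒳> n k q) ≡ ∑[ f ∈ allMaps n q ] ∏ (strict f) G
coeff-𝒳> {n} {k} q G =
  trans (coeff-tabulated n k (λ G′ → + χ> G′ q) G)
        (count-∏ (λ f e → does (suc (colour f (proj₂ e)) ≤? colour f (proj₁ e))) G)

corollary1p3 : (n k : ℕ) → 1 ≤ n → (q : ℕ) → 1 ≤ q → (H : Graph n k) →
    coeff H (Δ (𝒳≥ n k q)) ≡ sgn k * coeff H (𝒳> n k q)
corollary1p3 n k _ q _ H = begin
    coeff H (Δ (𝒳≥ n k q))
      ≡⟨ coeff-foldr-B (allFin k) (𝒳≥ n k q) H ⟩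
    foldr Bᵀ (λ G → coeff G (𝒳≥ n k q)) (allFin k) H
      ≡⟨ foldr-Bᵀ-cong (allFin k) (coeff-𝒳≥ q) H ⟩
    foldr Bᵀ (λ G → ∑[ f ∈ maps ] ∏ (weak f) G) (allFin k) H
      ≡⟨ foldr-Bᵀ-∑ (allFin k) maps (λ f → ∏ (weak f)) H ⟩
    ∑[ f ∈ maps ] foldr Bᵀ (∏ (weak f)) (allFin k) H
      ≡⟨ ∑-cong maps (λ f → trans (Δᵀ-∏ k (weak f) H) (∏-cong (∂-weak f) H)) ⟩
    ∑[ f ∈ maps ] ∏ (λ e → - ascent f e) H
      ≡⟨ ∑-cong maps (λ f → ∏-neg (ascent f) H) ⟩
    ∑[ f ∈ maps ] sgn k * ∏ (ascent f) H
      ≡⟨ ∑-*ˡ (sgn k) maps (λ f → ∏ (ascent f) H) ⟩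
    sgn k * (∑[ f ∈ maps ] ∏ (ascent f) H)
      ≡⟨ cong (sgn k *_) (ascents≡descents H) ⟩
    sgn k * (∑[ f ∈ maps ] ∏ (strict f) H)
      ≡⟨ cong (sgn k *_) (sym (coeff-𝒳> q H)) ⟩
    sgn k * coeff H (𝒳> n k q) ∎
  where
  open ≡-Reasoning
  maps : List (Vec (Fin q) n)
  maps = allMaps n q
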